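{- Every term of type $\Diamond$ contains a free variable; i.e., if $\Gamma\vdash t:\Diamond$, then $\Gamma\neq\emptyset$ (indeed $t$ has at least one free variable).
   Context: Linear types are generated by $\rho,\tau ::= \Diamond \mid \mathbf{B} \mid \tau\multimap\rho \mid \tau\otimes\rho \mid \tau\times\rho \mid \mathbf{L}(\tau)$. There are infinitely many variables of each type; $x^\tau$ denotes a variable $x$ of type $\tau$. Raw terms are $r,s,t ::= x^\tau \mid c \mid \lambda x^\tau.t \mid \langle t,s\rangle \mid t s \mid \{t\}$, where the constants $c$ are $\mathsf{tt},\mathsf{ff}$ of type $\mathbf B$, $\mathsf{nil}_\tau$ of type $\mathbf L(\tau)$, $\mathsf{cons}_\tau$ of type $\Diamond\multimap\tau\multimap\mathbf L(\tau)\multimap\mathbf L(\tau)$, and $\otimes_{\tau,\rho}$ of type $\tau\multimap\rho\multimap\tau\otimes\rho$. Application associates to the left, $\lambda x,y.t$ abbreviates $\lambda x.\lambda y.t$, and $\alpha$-equivalent terms are identified. A context is a finite set of variables; $\Gamma_1,\Gamma_2$ denotes $\Gamma_1\cup\Gamma_2$ where these are disjoint. The typing relation $\Gamma\vdash t:\tau$ is inductively defined by: (Var) $\Gamma,x^\tau\vdash x:\tau$; (Const) $\Gamma\vdash c:\tau$ if $c$ has type $\tau$; ($\multimap^+$) from $\Gamma\cup\{x^\tau\}\vdash t:\rho$ infer $\Gamma\vdash\lambda x^\tau.t:\tau\multimap\rho$; ($\multimap^-$) from $\Gamma_1\vdash t:\tau\multimap\rho$ and $\Gamma_2\vdash s:\tau$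 infer $\Gamma_1,\Gamma_2\vdash ts:\rho$; ($\times^+$) from $\Gamma\vdash t:\tau$ and $\Gamma\vdash s:\rho$ infer $\Gamma\vdash\langle t,s\rangle:\tau\times\rho$; ($\times^-$) from $\Gamma\vdash t:\tau\times\rho$ infer $\Gamma\vdash t\,\mathsf{tt}:\tau$ and $\Gamma\vdash t\,\mathsf{ff}:\rho$; ($\mathbf B^-$) from $\Gamma_1\vdash t:\mathbf B$, $\Gamma_2\vdash s:\tau$, $\Gamma_2\vdash r:\tau$ infer $\Gamma_1,\Gamma_2\vdash t\langle s,r\rangle:\tau$; ($\otimes^-$) from $\Gamma_1\vdash t:\tau\otimes\rho$ and $\Gamma_2,x^\tau,y^\rho\vdash s:\sigma$ infer $\Gamma_1,\Gamma_2\vdash t(\lambda x^\tau,y^\rho.s):\sigma$; ($\mathbf L^-$) from $\Gamma\vdash t:\mathbf L(\tau)$ and $\emptyset\vdash s:\Diamond\multimap\tau\multimap\rho\multimap\rho$ infer $\Gamma\vdash t\{s\}:\rho\multimap\rho$. -}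

module Defs where

open import Data.Nat using (ℕ)
open import Data.Product using (_×_; Σ; _,_; proj₂)
open import Data.Sum using (_⊎_)
open import Data.Empty using (⊥)
open import Data.List using (List; []; _∷_)
open import Data.List.Membership.Propositional using (_∈_)
open import Relation.Binary.PropositionalEquality using (_≡_)
open import Relation.Nullary using (¬_)

data Ty : Set where
  ◇    : Ty
  𝐁    : Ty
  _⊸_  : Ty → Ty → Ty
  _⊗_  : Ty → Ty → Ty
  _×ᵗ_ : Ty → Ty → Ty
  𝐋    : Ty → Ty

infixr 5 _⊸_

Var : Set
Var = ℕ × Ty

data Const : Set where
  tt ff  : Const
  nil    : Ty → Const
  cons   : Ty → Const
  tensor : Ty → Ty → Const

data ConstTy : Const → Ty → Set where
  tt-ty     : ConstTy tt 𝐁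
  ff-ty     : ConstTy ff 𝐁
  nil-ty    : ∀ τ → ConstTy (nil τ) (𝐋 τ)
  cons-ty   : ∀ τ → ConstTy (cons τ) (◇ ⊸ τ ⊸ 𝐋 τ ⊸ 𝐋 τ)
  tensor-ty : ∀ τ ρ → ConstTy (tensor τ ρ) (τ ⊸ ρ ⊸ (τ ⊗ ρ))

data Term : Set where
  var   : Var → Term
  const : Const → Term
  lam   : Var → Term → Term
  pair  : Term → Term → Term
  app   : Term → Term → Term
  brace : Term → Term

data FreeIn (v : Var) : Term → Set where
  fv-var   : FreeIn v (var v)
  fv-lam   : ∀ {w t} → ¬ (v ≡ w) → FreeIn v t → FreeIn v (lam w t)
  fv-pairˡ : ∀ {t s} → FreeIn v t → FreeIn v (pair t s)
  fv-pairʳ : ∀ {t s} → FreeIn v s → FreeIn v (pair t s)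
  fv-appˡ  : ∀ {t s} → FreeIn v t → FreeIn v (app t s)
  fv-appʳ  : ∀ {t s} → FreeIn v s → FreeIn v (app t s)
  fv-brace : ∀ {t} → FreeIn v t → FreeIn v (brace t)

-- Contexts: finite sets of variables, represented by lists up to membership.
Ctx : Set
Ctx = List Var

Union : Ctx → Ctx → Ctx → Set
Union Γ Γ₁ Γ₂ = ∀ v → (v ∈ Γ → v ∈ Γ₁ ⊎ v ∈ Γ₂) × (v ∈ Γ₁ ⊎ v ∈ Γ₂ → v ∈ Γ)

Disjoint : Ctx → Ctx → Set
Disjoint Γ₁ Γ₂ = ∀ v → v ∈ Γ₁ → v ∈ Γ₂ → ⊥

DisjUnion : Ctx → Ctx → Ctx → Set
DisjUnion Γ Γ₁ Γ₂ = Union Γ Γ₁ Γ₂ × Disjoint Γ₁ Γ₂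

data _⊢_∶_ : Ctx → Term → Ty → Set where
  ty-var   : ∀ {Γ x} → x ∈ Γ → Γ ⊢ var x ∶ proj₂ x
  ty-const : ∀ {Γ c τ} → ConstTy c τ → Γ ⊢ const c ∶ τ
  ty-lam   : ∀ {Γ Γx x τ t ρ} → Union Γx Γ ((x , τ) ∷ []) →
             Γx ⊢ t ∶ ρ → Γ ⊢ lam (x , τ) t ∶ (τ ⊸ ρ)
  ty-app   : ∀ {Γ Γ₁ Γ₂ t s τ ρ} → DisjUnion Γ Γ₁ Γ₂ →
             Γ₁ ⊢ t ∶ (τ ⊸ ρ) → Γ₂ ⊢ s ∶ τ → Γ ⊢ app t s ∶ ρ
  ty-pair  : ∀ {Γ t s τ ρ} → Γ ⊢ t ∶ τ → Γ ⊢ s ∶ ρ → Γ ⊢ pair t s ∶ (τ ×ᵗ ρ)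
  ty-fst   : ∀ {Γ t τ ρ} → Γ ⊢ t ∶ (τ ×ᵗ ρ) → Γ ⊢ app t (const tt) ∶ τ
  ty-snd   : ∀ {Γ t τ ρ} → Γ ⊢ t ∶ (τ ×ᵗ ρ) → Γ ⊢ app t (const ff) ∶ ρ
  ty-case  : ∀ {Γ Γ₁ Γ₂ t s r τ} → DisjUnion Γ Γ₁ Γ₂ →
             Γ₁ ⊢ t ∶ 𝐁 → Γ₂ ⊢ s ∶ τ → Γ₂ ⊢ r ∶ τ → Γ ⊢ app t (pair s r) ∶ τ
  ty-tens  : ∀ {Γ Γ₁ Γ₂ Γ₂xy t s x y τ ρ σ} → DisjUnion Γ Γ₁ Γ₂ →
             Γ₁ ⊢ t ∶ (τ ⊗ ρ) →
             DisjUnion Γ₂xy Γ₂ ((x , τ) ∷ (y , ρ) ∷ []) → ¬ ((x , τ) ≡ (y , ρ)) →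
             Γ₂xy ⊢ s ∶ σ → Γ ⊢ app t (lam (x , τ) (lam (y , ρ) s)) ∶ σ
  ty-list  : ∀ {Γ t s τ ρ} → Γ ⊢ t ∶ 𝐋 τ → [] ⊢ s ∶ (◇ ⊸ τ ⊸ ρ ⊸ ρ) →
             Γ ⊢ app t (brace s) ∶ (ρ ⊸ ρ)

{-# OPTIONS --safe #-}
-- Interpret types as sets, with ◇ denoting an arbitrary set R.  Every
-- constant has a denotation that never has to produce an element of R (cons
-- only consumes one), so every typed term denotes a function of the values of
-- its free variables; and every type is inhabited as soon as R is.  Taking R
-- to be the set of free variables of t, each free variable v can be sent to a
-- value built from v itself, and evaluating t, of type ◇, yields a free variable.
module Submission where

open import Defs
open import Data.Product using (_×_; ∃)
open import Data.List using ([])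
open import Relation.Binary.PropositionalEquality using (_≢_)

open import Data.Bool using (Bool; true; false; if_then_else_)
open import Data.Empty using (⊥-elim)
open import Data.List using (List; _∷_; foldr)
open import Data.List.Membership.Propositional using (_∈_)
open import Data.List.Relation.Unary.Any using (here; there)
open import Data.List.Relation.Unary.Any.Properties using (¬Any[])
import Data.Nat as ℕ
open import Data.Product using (_,_; proj₁; proj₂)
open import Data.Product.Properties using (≡-dec)
open import Data.Sum using (_⊎_; inj₁; inj₂)
open import Function using (_∘_)
open import Relation.Binary.Definitions using (DecidableEquality)
open import Relation.Binary.PropositionalEquality using (_≡_; refl; cong; cong₂)
open import Relation.Nullary using (Dec; yes; no)
open import Relation.Nullary.Decidable using (map′; _×-dec_)

head : Ty → ℕ.ℕ
head ◇        = 0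
head 𝐁        = 1
head (_ ⊸ _)  = 2
head (_ ⊗ _)  = 3
head (_ ×ᵗ _) = 4
head (𝐋 _)    = 5

infix 4 _≟ᵗ_ _≟ᵛ_

-- Types with different heads are told apart by `head`, so only the
-- same-head cases need to be written out.
_≟ᵗ_ : DecidableEquality Ty
σ ≟ᵗ τ with head σ ℕ.≟ head τ
... | yes same = same-head σ τ same
  where
  same-head : ∀ σ τ → head σ ≡ head τ → Dec (σ ≡ τ)
  same-head ◇ ◇ refl = yes refl
  same-head 𝐁 𝐁 refl = yes refl
  same-head (a ⊸ b) (c ⊸ d) refl =
    map′ (λ (p , q) → cong₂ _⊸_ p q) (λ { refl → refl , refl }) (a ≟ᵗ c ×-dec b ≟ᵗ d)
  same-head (a ⊗ b) (c ⊗ d) refl =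
    map′ (λ (p , q) → cong₂ _⊗_ p q) (λ { refl → refl , refl }) (a ≟ᵗ c ×-dec b ≟ᵗ d)
  same-head (a ×ᵗ b) (c ×ᵗ d) refl =
    map′ (λ (p , q) → cong₂ _×ᵗ_ p q) (λ { refl → refl , refl }) (a ≟ᵗ c ×-dec b ≟ᵗ d)
  same-head (𝐋 a) (𝐋 c) refl = map′ (cong 𝐋) (λ { refl → refl }) (a ≟ᵗ c)
... | no different = no (different ∘ cong head)

_≟ᵛ_ : DecidableEquality Var
_≟ᵛ_ = ≡-dec ℕ._≟_ _≟ᵗ_

module _ {Γ Γ₁ Γ₂ : Ctx} {v : Var} (Γ=Γ₁∪Γ₂ : Union Γ Γ₁ Γ₂) where

  ∈-∪⁻ : v ∈ Γ → v ∈ Γ₁ ⊎ v ∈ Γ₂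
  ∈-∪⁻ = proj₁ (Γ=Γ₁∪Γ₂ v)

  ∈-∪⁺ˡ : v ∈ Γ₁ → v ∈ Γ
  ∈-∪⁺ˡ = proj₂ (Γ=Γ₁∪Γ₂ v) ∘ inj₁

  ∈-∪⁺ʳ : v ∈ Γ₂ → v ∈ Γ
  ∈-∪⁺ʳ = proj₂ (Γ=Γ₁∪Γ₂ v) ∘ inj₂

free⇒∈ctx : ∀ {Γ t τ v} → Γ ⊢ t ∶ τ → FreeIn v t → v ∈ Γ
free⇒∈ctx (ty-var x∈Γ) fv-var = x∈Γ
free⇒∈ctx (ty-lam Γx=Γ∪x ⊢t) (fv-lam v≢x v∈t) with ∈-∪⁻ Γx=Γ∪x (free⇒∈ctx ⊢t v∈t)
... | inj₁ v∈Γ       = v∈Γ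
... | inj₂ (here v≡x) = ⊥-elim (v≢x v≡x)
free⇒∈ctx (ty-app (∪ , _) ⊢t _) (fv-appˡ v∈t) = ∈-∪⁺ˡ ∪ (free⇒∈ctx ⊢t v∈t)
free⇒∈ctx (ty-app (∪ , _) _ ⊢s) (fv-appʳ v∈s) = ∈-∪⁺ʳ ∪ (free⇒∈ctx ⊢s v∈s)
free⇒∈ctx (ty-pair ⊢t _) (fv-pairˡ v∈t) = free⇒∈ctx ⊢t v∈t
free⇒∈ctx (ty-pair _ ⊢s) (fv-pairʳ v∈s) = free⇒∈ctx ⊢s v∈s
free⇒∈ctx (ty-fst ⊢t) (fv-appˡ v∈t) = free⇒∈ctx ⊢t v∈t
free⇒∈ctx (ty-snd ⊢t) (fv-appˡ v∈t) = free⇒∈ctx ⊢t v∈t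
free⇒∈ctx (ty-case (∪ , _) ⊢t _ _) (fv-appˡ v∈t) = ∈-∪⁺ˡ ∪ (free⇒∈ctx ⊢t v∈t)
free⇒∈ctx (ty-case (∪ , _) _ ⊢s _) (fv-appʳ (fv-pairˡ v∈s)) = ∈-∪⁺ʳ ∪ (free⇒∈ctx ⊢s v∈s)
free⇒∈ctx (ty-case (∪ , _) _ _ ⊢r) (fv-appʳ (fv-pairʳ v∈r)) = ∈-∪⁺ʳ ∪ (free⇒∈ctx ⊢r v∈r)
free⇒∈ctx (ty-tens (∪ , _) ⊢t _ _ _) (fv-appˡ v∈t) = ∈-∪⁺ˡ ∪ (free⇒∈ctx ⊢t v∈t)
free⇒∈ctx (ty-tens (∪ , _) _ (∪xy , _) _ ⊢s) (fv-appʳ (fv-lam v≢x (fv-lam v≢y v∈s)))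
  with ∈-∪⁻ ∪xy (free⇒∈ctx ⊢s v∈s)
... | inj₁ v∈Γ₂               = ∈-∪⁺ʳ ∪ v∈Γ₂
... | inj₂ (here v≡x)         = ⊥-elim (v≢x v≡x)
... | inj₂ (there (here v≡y)) = ⊥-elim (v≢y v≡y)
free⇒∈ctx (ty-list ⊢t _) (fv-appˡ v∈t) = free⇒∈ctx ⊢t v∈t
free⇒∈ctx (ty-list _ ⊢s) (fv-appʳ (fv-brace v∈s)) = ⊥-elim (¬Any[] (free⇒∈ctx ⊢s v∈s))

module Model (R : Set) where

  ⟦_⟧ : Ty → Set
  ⟦ ◇ ⟧      = R
  ⟦ 𝐁 ⟧      = Bool
  ⟦ σ ⊸ τ ⟧  = ⟦ σ ⟧ → ⟦ τ ⟧
  ⟦ σ ⊗ τ ⟧  = ⟦ σ ⟧ × ⟦ τ ⟧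
  ⟦ σ ×ᵗ τ ⟧ = ⟦ σ ⟧ × ⟦ τ ⟧
  -- The ◇-argument of each cons is kept: the fold hands it back to the step function.
  ⟦ 𝐋 σ ⟧    = List (R × ⟦ σ ⟧)

  inhabitant : R → (τ : Ty) → ⟦ τ ⟧
  inhabitant r ◇        = r
  inhabitant r 𝐁        = true
  inhabitant r (σ ⊸ τ)  = λ _ → inhabitant r τ
  inhabitant r (σ ⊗ τ)  = inhabitant r σ , inhabitant r τ
  inhabitant r (σ ×ᵗ τ) = inhabitant r σ , inhabitant r τ
  inhabitant r (𝐋 σ)    = []

  ⟦_⟧ᶜ : ∀ {c τ} → ConstTy c τ → ⟦ τ ⟧
  ⟦ tt-ty ⟧ᶜ         = true
  ⟦ ff-ty ⟧ᶜ         = false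
  ⟦ nil-ty _ ⟧ᶜ      = []
  ⟦ cons-ty _ ⟧ᶜ     = λ r a as → (r , a) ∷ as
  ⟦ tensor-ty _ _ ⟧ᶜ = _,_

  Env : Term → Set
  Env t = ∀ {v} → FreeIn v t → ⟦ proj₂ v ⟧

  extend : ∀ {x τ t} → Env (lam (x , τ) t) → ⟦ τ ⟧ → Env t
  extend {x} {τ} ρ a {v} v∈t with v ≟ᵛ (x , τ)
  ... | yes refl = a
  ... | no v≢x   = ρ (fv-lam v≢x v∈t)

  eval : ∀ {Γ t τ} → Γ ⊢ t ∶ τ → Env t → ⟦ τ ⟧
  eval (ty-var _)   ρ = ρ fv-var
  eval (ty-const c) ρ = ⟦ c ⟧ᶜ
  eval (ty-lam _ ⊢t) ρ = λ a → eval ⊢t (extend ρ a)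
  eval (ty-app _ ⊢t ⊢s) ρ = eval ⊢t (ρ ∘ fv-appˡ) (eval ⊢s (ρ ∘ fv-appʳ))
  eval (ty-pair ⊢t ⊢s) ρ = eval ⊢t (ρ ∘ fv-pairˡ) , eval ⊢s (ρ ∘ fv-pairʳ)
  eval (ty-fst ⊢t) ρ = proj₁ (eval ⊢t (ρ ∘ fv-appˡ))
  eval (ty-snd ⊢t) ρ = proj₂ (eval ⊢t (ρ ∘ fv-appˡ))
  eval (ty-case _ ⊢t ⊢s ⊢r) ρ =
    if eval ⊢t (ρ ∘ fv-appˡ)
    then eval ⊢s (ρ ∘ fv-appʳ ∘ fv-pairˡ)
    else eval ⊢r (ρ ∘ fv-appʳ ∘ fv-pairʳ)
  eval (ty-tens _ ⊢t _ _ ⊢s) ρ =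
    let a , b = eval ⊢t (ρ ∘ fv-appˡ)
    in  eval ⊢s (extend (extend (ρ ∘ fv-appʳ) a) b)
  eval (ty-list ⊢t ⊢s) ρ z =
    foldr (λ (r , a) → eval ⊢s (ρ ∘ fv-appʳ ∘ fv-brace) r a) z (eval ⊢t (ρ ∘ fv-appˡ))

lemma4p3 : ∀ (Γ : Ctx) (t : Term) → Γ ⊢ t ∶ ◇ → (Γ ≢ []) × (∃ λ v → FreeIn v t)
lemma4p3 Γ t ⊢t = Γ≢[] , free
  where
  open Model (∃ λ v → FreeIn v t)

  free : ∃ λ v → FreeIn v t
  free = eval ⊢t (λ {v} v∈t → inhabitant (v , v∈t) (proj₂ v))

  Γ≢[] : Γ ≢ []
  Γ≢[] refl = ¬Any[] (free⇒∈ctx ⊢t (proj₂ free))
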